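{- Let $G=(V,E)$ be a finite connected graph (parallel edges allowed, no loops), let $D\ge 0$ be an effective divisor on $G$, and let $u,v\in V$. Then $u\not\equiv_D v$ if and only if there exist an effective divisor $D'\sim D$ and a subset $U\subseteq V$ with $u\in U$, $v\notin U$ such that $D'-Q(G)\mathbf{1}_U$ is effective. In particular, $u\equiv_D v$ if every $u$--$v$ cut (set of edges $E(U,V\setminus U)$ with $u\in U$, $v\notin U$) has more than $\deg(D)$ edges.
   Context: The Laplacian $Q(G)\in\mathbb{Z}^{V\times V}$ has $Q(G)_{ww}=\deg(w)$ and $Q(G)_{wz}=-(\text{number of edges between }w\text{ and }z)$ for $w\ne z$. A divisor is $D\in\mathbb{Z}^V$, $\deg(D)=\sum_w D(w)$, effective if $D\ge0$; $D\sim D'$ if $D-D'=Q(G)x$ for some $x\in\mathbb{Z}^V$. $\mathbf{1}_U$ denotes the incidence vector of $U\subseteq V$. For an effective divisor $D$, the relation $\equiv_D$ on $V$ is defined by $u\equiv_D v$ iff $x_u=x_v$ for every $x\in\mathbb{Z}^V$ with $D-Q(G)x\ge0$. -}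

module Defs where

open import Data.Nat as ℕ using (ℕ; zero; suc)
open import Data.Integer as ℤ using (ℤ; +_; _+_; _-_; _*_; -_; 0ℤ; 1ℤ)
open import Data.Fin using (Fin; zero; suc; _≟_)
open import Data.Fin.Subset using (Subset; _∈_; _∉_; inside; outside)
open import Data.Vec using (lookup)
open import Data.Bool using (Bool; true; false; if_then_else_; _∧_; not)
open import Data.Product using (Σ; _×_; ∃)
open import Relation.Nullary using (¬_; does)
open import Relation.Binary.PropositionalEquality using (_≡_)

sumℤ : ∀ {n} → (Fin n → ℤ) → ℤ
sumℤ {zero}  f = 0ℤ
sumℤ {suc n} f = f zero + sumℤ (λ i → f (suc i))

sumℕ : ∀ {n} → (Fin n → ℕ) → ℕ
sumℕ {zero}  f = 0
sumℕ {suc n} f = f zero ℕ.+ sumℕ (λ i → f (suc i))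

record Graph (n : ℕ) : Set where
  field
    adj      : Fin n → Fin n → ℕ          -- number of edges between w and z
    adj-sym  : ∀ w z → adj w z ≡ adj z w
    loopless : ∀ w → adj w w ≡ 0
open Graph public

data Reach {n} (G : Graph n) : Fin n → Fin n → Set where
  here : ∀ {u} → Reach G u u
  step : ∀ {u w v} → 0 ℕ.< adj G u w → Reach G w v → Reach G u v

Connected : ∀ {n} → Graph n → Set
Connected G = ∀ u v → Reach G u v

degree : ∀ {n} → Graph n → Fin n → ℕ
degree G w = sumℕ (λ z → adj G w z)

Q : ∀ {n} → Graph n → Fin n → Fin n → ℤ
Q G w z = if does (w ≟ z) then + degree G w else - (+ adj G w z)

Qx : ∀ {n} → Graph n → (Fin n → ℤ) → Fin n → ℤ
Qx G x w = sumℤ (λ z → Q G w z * x z)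

Divisor : ℕ → Set
Divisor n = Fin n → ℤ

deg : ∀ {n} → Divisor n → ℤ
deg D = sumℤ D

Effective : ∀ {n} → Divisor n → Set
Effective D = ∀ w → 0ℤ ℤ.≤ D w

LinEquiv : ∀ {n} → Graph n → Divisor n → Divisor n → Set
LinEquiv G D D' = Σ (Fin _ → ℤ) λ x → ∀ w → D w - D' w ≡ Qx G x w

_─Q_·_ : ∀ {n} → Divisor n → Graph n → (Fin n → ℤ) → Divisor n
(D ─Q G · x) w = D w - Qx G x w

EquivD : ∀ {n} → Graph n → Divisor n → Fin n → Fin n → Set
EquivD G D u v = ∀ (x : Fin _ → ℤ) → Effective (D ─Q G · x) → x u ≡ x v

𝟏 : ∀ {n} → Subset n → Fin n → ℤ
𝟏 U w = if lookup U w then 1ℤ else 0ℤ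

cutSize : ∀ {n} → Graph n → Subset n → ℕ
cutSize G U = sumℕ (λ w → sumℕ (λ z →
  if lookup U w ∧ not (lookup U z) then adj G w z else 0))

-- Call an integer vector x a legal script for D when D − Q x is effective.  Legal scripts are
-- closed under pointwise maxima and under adding constants.  Hence if x is legal with x u < x v,
-- then x ⊔ x(u) and x ⊔ (x(u) + 1) are legal and differ exactly by 𝟏_U for U = {x ≤ x(u)}; with
-- D' = D − Q (x ⊔ x(u)) this is the required D' ~ D and set U.  Conversely such D' and U give
-- two legal scripts differing by 𝟏_U, which cannot both be constant on {u, v}.
--
-- The sum of (Q x)(w) over a set W is the total flow a_wz (x w − x z) leaving W.  For x = 𝟏_U this
-- is the size of the cut, so D' − Q 𝟏_U ≥ 0 forces |E(U, V∖U)| ≤ deg D' = deg D.  For a legal x and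
-- W = {x ≥ x a} it bounds x a − x b by deg D along every edge ab; in a connected graph legal scripts
-- normalised at v therefore lie in a finite box, which makes u ≡_D v decidable and turns the
-- double negation in "u ≢_D v" into an actual script.
module Submission where

open import Defs
open import Data.Nat as ℕ using (ℕ; zero; suc; s≤s)
import Data.Nat.Properties as ℕₚ
open import Data.Integer as ℤ using (ℤ; +_; _+_; _-_; _*_; -_; 0ℤ; 1ℤ; _≤_; _<_; _⊔_; +≤+)
import Data.Integer.Properties as ℤₚ
open import Data.Integer.Tactic.RingSolver using (solve-∀)
open import Data.Fin using (Fin; zero; suc; _≟_; toℕ; fromℕ<; finToFun; funToFin)
open import Data.Fin.Properties using (any?; all?; toℕ-fromℕ<; finToFun-funToFin)
open import Data.Fin.Subset using (Subset; _∈_; _∉_; ∁)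
open import Data.Fin.Subset.Properties using (x∉p⇒x∈∁p; x∈p⇒x∉∁p)
open import Data.Vec using (lookup; tabulate)
open import Data.Vec.Properties using (lookup∘tabulate; []=⇒lookup; lookup⇒[]=; lookup-map)
open import Data.Bool using (Bool; true; false; if_then_else_; _∧_; not)
open import Data.Product using (Σ; _×_; _,_; ∃; proj₁; proj₂)
open import Data.Sum using (_⊎_; inj₁; inj₂)
open import Function using (_∘_)
open import Function.Bundles using (_⇔_; mk⇔)
open import Relation.Nullary using (¬_; Dec; yes; no; does; contradiction)
open import Relation.Nullary.Decidable
  using (map′; dec-true; dec-false; _×-dec_; ¬?; decidable-stable)
open import Relation.Unary using (Pred; Decidable)
open import Relation.Binary.Definitions using (tri<; tri≈; tri>)
open import Relation.Binary.PropositionalEquality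
open import Algebra.Properties.Semiring.Sum ℤₚ.+-*-semiring
  using (sum; sum-cong-≗; ∑-distrib-+; ∑-comm; sum-replicate-zero; *-distribʳ-sum)
open import Algebra.Properties.AbelianGroup ℤₚ.+-0-abelianGroup
  using (identityˡ-unique; inverseʳ-unique; ∙-cancelˡ; ∙-cancelʳ)

sumℤ≡sum : ∀ {n} (f : Fin n → ℤ) → sumℤ f ≡ sum f
sumℤ≡sum {zero}  f = refl
sumℤ≡sum {suc n} f = cong (_+_ (f zero)) (sumℤ≡sum (f ∘ suc))

sumℕ≡sum : ∀ {n} (f : Fin n → ℕ) → + sumℕ f ≡ sum (+_ ∘ f)
sumℕ≡sum {zero}  f = refl
sumℕ≡sum {suc n} f = cong (_+_ (+ f zero)) (sumℕ≡sum (f ∘ suc))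

sum-mono-≤ : ∀ {n} {f g : Fin n → ℤ} → (∀ i → f i ≤ g i) → sum f ≤ sum g
sum-mono-≤ {zero}  f≤g = ℤₚ.≤-refl
sum-mono-≤ {suc n} f≤g = ℤₚ.+-mono-≤ (f≤g zero) (sum-mono-≤ (f≤g ∘ suc))

sum-nonneg : ∀ {n} {f : Fin n → ℤ} → (∀ i → 0ℤ ≤ f i) → 0ℤ ≤ sum f
sum-nonneg {n} {f} f≥0 = subst (_≤ sum f) (sum-replicate-zero n) (sum-mono-≤ f≥0)

≤-sum : ∀ {n} {f : Fin n → ℤ} → (∀ i → 0ℤ ≤ f i) → ∀ j → f j ≤ sum f
≤-sum {suc n} {f} f≥0 zero    = subst (_≤ sum f) (ℤₚ.+-identityʳ (f zero))
  (ℤₚ.+-monoʳ-≤ (f zero) (sum-nonneg (f≥0 ∘ suc)))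
≤-sum {suc n} {f} f≥0 (suc j) = ℤₚ.≤-trans (≤-sum (f≥0 ∘ suc) j)
  (subst (_≤ sum f) (ℤₚ.+-identityˡ _) (ℤₚ.+-monoˡ-≤ _ (f≥0 zero)))

≤-sumℕ : ∀ {n} (f : Fin n → ℕ) j → f j ℕ.≤ sumℕ f
≤-sumℕ f zero    = ℕₚ.m≤m+n _ _
≤-sumℕ f (suc j) = ℕₚ.≤-trans (≤-sumℕ (f ∘ suc) j) (ℕₚ.m≤n+m _ _)

sum-δ : ∀ {n} (w : Fin n) (c : ℤ) → sum (λ z → if does (w ≟ z) then c else 0ℤ) ≡ c
sum-δ {suc n} zero    c = trans (cong (_+_ c) (sum-replicate-zero n)) (ℤₚ.+-identityʳ c)
sum-δ {suc n} (suc w) c = trans (ℤₚ.+-identityˡ _) (sum-δ w c)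

i+i≡0⇒i≡0 : ∀ i → i + i ≡ 0ℤ → i ≡ 0ℤ
i+i≡0⇒i≡0 (+ zero) _ = refl

∑∑-antisym : ∀ {n} (g : Fin n → Fin n → ℤ) → (∀ w z → g z w ≡ - g w z) →
             sum (λ w → sum (g w)) ≡ 0ℤ
∑∑-antisym {n} g g-anti = i+i≡0⇒i≡0 _ (begin
  S + S                                      ≡⟨ cong (_+_ S) (∑-comm (λ w z → g z w)) ⟨
  S + sum (λ w → sum (λ z → g z w))          ≡⟨ ∑-distrib-+ (λ w → sum (g w)) _ ⟨
  sum (λ w → sum (g w) + sum (λ z → g z w))  ≡⟨ sum-cong-≗ (λ w → ∑-distrib-+ (g w) _) ⟨
  sum (λ w → sum (λ z → g w z + g z w))      ≡⟨ sum-cong-≗ (λ w → sum-cong-≗ (cancel w)) ⟩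
  sum {n} (λ _ → sum {n} (λ _ → 0ℤ))         ≡⟨ sum-cong-≗ {n} (λ _ → sum-replicate-zero n) ⟩
  sum {n} (λ _ → 0ℤ)                         ≡⟨ sum-replicate-zero n ⟩
  0ℤ                                         ∎)
  where
  open ≡-Reasoning
  S = sum (λ w → sum (g w))
  cancel : ∀ w z → g w z + g z w ≡ 0ℤ
  cancel w z = trans (cong (_+_ (g w z)) (g-anti w z)) (ℤₚ.+-inverseʳ (g w z))

sumWhere : ∀ {n} → (Fin n → Bool) → (Fin n → ℤ) → ℤ
sumWhere p f = sum (λ w → if p w then f w else 0ℤ)

sumWhere≤sum : ∀ {n} (p : Fin n → Bool) {f g : Fin n → ℤ} →
               (∀ i → 0ℤ ≤ g i) → (∀ i → f i ≤ g i) → sumWhere p f ≤ sum g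
sumWhere≤sum p {f} {g} g≥0 f≤g = sum-mono-≤ bound
  where
  bound : ∀ i → (if p i then f i else 0ℤ) ≤ g i
  bound i with p i
  ... | true  = f≤g i
  ... | false = g≥0 i

deg-nonneg : ∀ {n} {D : Divisor n} → Effective D → 0ℤ ≤ deg D
deg-nonneg {D = D} D≥0 = subst (0ℤ ≤_) (sym (sumℤ≡sum D)) (sum-nonneg D≥0)

-- The Laplacian as a flow

module Laplacian {n : ℕ} (G : Graph n) where

  flow : (Fin n → ℤ) → Fin n → Fin n → ℤ
  flow x w z = + adj G w z * (x w - x z)

  flow-antisym : ∀ x w z → flow x z w ≡ - flow x w z
  flow-antisym x w z rewrite adj-sym G z w = reverse (+ adj G w z) (x w) (x z)
    where
    reverse : ∀ a b c → a * (c - b) ≡ - (a * (b - c))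
    reverse = solve-∀

  Q-row-sum : ∀ w → sum (Q G w) ≡ 0ℤ
  Q-row-sum w = identityˡ-unique _ _ (begin
    sum (Q G w) + sum (λ z → + adj G w z)                  ≡⟨ ∑-distrib-+ (Q G w) _ ⟨
    sum (λ z → Q G w z + + adj G w z)                      ≡⟨ sum-cong-≗ diagonal ⟩
    sum (λ z → if does (w ≟ z) then + degree G w else 0ℤ)  ≡⟨ sum-δ w _ ⟩
    + degree G w                                           ≡⟨ sumℕ≡sum (adj G w) ⟩
    sum (λ z → + adj G w z)                                ∎)
    where
    open ≡-Reasoning
    diagonal : ∀ z → Q G w z + + adj G w z ≡ (if does (w ≟ z) then + degree G w else 0ℤ)
    diagonal z with w ≟ z
    ... | yes refl rewrite loopless G w = ℤₚ.+-identityʳ _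
    ... | no _     = ℤₚ.+-inverseˡ (+ adj G w z)

  Qx≡∑flow : ∀ x w → Qx G x w ≡ sum (flow x w)
  Qx≡∑flow x w = begin
    Qx G x w                                    ≡⟨ sumℤ≡sum (λ z → Q G w z * x z) ⟩
    sum (λ z → Q G w z * x z)                   ≡⟨ sum-cong-≗ split ⟩
    sum (λ z → flow x w z + Q G w z * x w)      ≡⟨ ∑-distrib-+ (flow x w) _ ⟩
    sum (flow x w) + sum (λ z → Q G w z * x w)  ≡⟨ cong (_+_ (sum (flow x w))) (*-distribʳ-sum (x w) (Q G w)) ⟨
    sum (flow x w) + sum (Q G w) * x w          ≡⟨ cong (λ s → sum (flow x w) + s * x w) (Q-row-sum w) ⟩
    sum (flow x w) + 0ℤ * x w                   ≡⟨ ℤₚ.+-identityʳ _ ⟩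
    sum (flow x w)                              ∎
    where
    open ≡-Reasoning
    split : ∀ z → Q G w z * x z ≡ flow x w z + Q G w z * x w
    split z with w ≟ z
    ... | yes refl = diagonal (+ adj G w w) (+ degree G w) (x w)
      where
      diagonal : ∀ a d b → d * b ≡ a * (b - b) + d * b
      diagonal = solve-∀
    ... | no _ = offDiagonal (+ adj G w z) (x w) (x z)
      where
      offDiagonal : ∀ a b c → - a * c ≡ a * (b - c) + - a * b
      offDiagonal = solve-∀

  Qx-cong : ∀ {x y} → (∀ i → x i ≡ y i) → ∀ w → Qx G x w ≡ Qx G y w
  Qx-cong {x} {y} x≗y w = begin
    Qx G x w        ≡⟨ Qx≡∑flow x w ⟩
    sum (flow x w)  ≡⟨ sum-cong-≗ (λ z → cong₂ (λ a b → + adj G w z * (a - b)) (x≗y w) (x≗y z)) ⟩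
    sum (flow y w)  ≡⟨ Qx≡∑flow y w ⟨
    Qx G y w        ∎
    where open ≡-Reasoning

  Qx-+ : ∀ x y w → Qx G (λ i → x i + y i) w ≡ Qx G x w + Qx G y w
  Qx-+ x y w = begin
    Qx G (λ i → x i + y i) w                ≡⟨ Qx≡∑flow _ w ⟩
    sum (λ z → flow (λ i → x i + y i) w z)  ≡⟨ sum-cong-≗ (λ z → distrib (+ adj G w z) (x w) (y w) (x z) (y z)) ⟩
    sum (λ z → flow x w z + flow y w z)     ≡⟨ ∑-distrib-+ (flow x w) (flow y w) ⟩
    sum (flow x w) + sum (flow y w)         ≡⟨ cong₂ _+_ (Qx≡∑flow x w) (Qx≡∑flow y w) ⟨
    Qx G x w + Qx G y w                     ∎
    where
    open ≡-Reasoning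
    distrib : ∀ a b c d e → a * ((b + c) - (d + e)) ≡ a * (b - d) + a * (c - e)
    distrib = solve-∀

  Qx-const : ∀ c w → Qx G (λ _ → c) w ≡ 0ℤ
  Qx-const c w = trans (Qx≡∑flow _ w)
    (trans (sum-cong-≗ (λ z → vanish (+ adj G w z) c)) (sum-replicate-zero n))
    where
    vanish : ∀ a c → a * (c - c) ≡ 0ℤ
    vanish = solve-∀

  Qx-+const : ∀ x c w → Qx G (λ i → x i + c) w ≡ Qx G x w
  Qx-+const x c w =
    trans (Qx-+ x _ w) (trans (cong (_+_ (Qx G x w)) (Qx-const c w)) (ℤₚ.+-identityʳ _))

  Qx-neg : ∀ x w → Qx G (λ i → - x i) w ≡ - Qx G x w
  Qx-neg x w = inverseʳ-unique _ _ (begin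
    Qx G x w + Qx G (λ i → - x i) w  ≡⟨ Qx-+ x _ w ⟨
    Qx G (λ i → x i + - x i) w       ≡⟨ Qx-cong (λ i → ℤₚ.+-inverseʳ (x i)) w ⟩
    Qx G (λ _ → 0ℤ) w                ≡⟨ Qx-const 0ℤ w ⟩
    0ℤ                               ∎)
    where open ≡-Reasoning

  Qx-antitone : ∀ {x y} w → x w ≡ y w → (∀ z → x z ≤ y z) → Qx G y w ≤ Qx G x w
  Qx-antitone {x} {y} w xw≡yw x≤y = subst₂ _≤_ (sym (Qx≡∑flow y w)) (sym (Qx≡∑flow x w))
    (sum-mono-≤ λ z → ℤₚ.*-monoˡ-≤-nonNeg (+ adj G w z)
      (subst (λ t → t - y z ≤ x w - x z) xw≡yw (ℤₚ.+-monoʳ-≤ (x w) (ℤₚ.neg-mono-≤ (x≤y z)))))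

  flow-nonneg : ∀ x {w z} → x z ≤ x w → 0ℤ ≤ flow x w z
  flow-nonneg x {w} {z} xz≤xw = subst (_≤ flow x w z) (ℤₚ.*-zeroʳ (+ adj G w z))
    (ℤₚ.*-monoˡ-≤-nonNeg (+ adj G w z) (ℤₚ.i≤j⇒0≤j-i xz≤xw))

  difference≤flow : ∀ x {w z} → 0 ℕ.< adj G w z → x z ≤ x w → x w - x z ≤ flow x w z
  difference≤flow x {w} {z} wz xz≤xw with adj G w z | wz
  ... | suc k | _ = subst (_≤ + suc k * (x w - x z)) (ℤₚ.*-identityˡ (x w - x z))
    (ℤₚ.*-monoʳ-≤-nonNeg (x w - x z) {{ℤ.nonNegative (ℤₚ.i≤j⇒0≤j-i xz≤xw)}}
                         {1ℤ} {+ suc k} (+≤+ (s≤s ℕ.z≤n)))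

  outflow : (Fin n → Bool) → (Fin n → ℤ) → ℤ
  outflow p x = sum (λ w → sum (λ z → if p w ∧ not (p z) then flow x w z else 0ℤ))

  sumWhere-Qx : ∀ p x → sumWhere p (Qx G x) ≡ outflow p x
  sumWhere-Qx p x = begin
    sumWhere p (Qx G x)                              ≡⟨ sum-cong-≗ split ⟩
    sum (λ w → sum (λ z → inside w z + across w z))  ≡⟨ sum-cong-≗ (λ w → ∑-distrib-+ (inside w) (across w)) ⟩
    sum (λ w → sum (inside w) + sum (across w))      ≡⟨ ∑-distrib-+ (λ w → sum (inside w)) _ ⟩
    sum (λ w → sum (inside w)) + outflow p x         ≡⟨ cong (_+ outflow p x) (∑∑-antisym inside inside-antisym) ⟩
    0ℤ + outflow p x                                 ≡⟨ ℤₚ.+-identityˡ _ ⟩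
    outflow p x                                      ∎
    where
    open ≡-Reasoning
    inside across : Fin n → Fin n → ℤ
    inside w z = if p w ∧ p z then flow x w z else 0ℤ
    across w z = if p w ∧ not (p z) then flow x w z else 0ℤ
    inside-antisym : ∀ w z → inside z w ≡ - inside w z
    inside-antisym w z with p w | p z
    ... | true  | true  = flow-antisym x w z
    ... | true  | false = refl
    ... | false | true  = refl
    ... | false | false = refl
    by-side : ∀ w z → flow x w z ≡
              (if p z then flow x w z else 0ℤ) + (if not (p z) then flow x w z else 0ℤ)
    by-side w z with p z
    ... | true  = sym (ℤₚ.+-identityʳ _)
    ... | false = sym (ℤₚ.+-identityˡ _)
    split : ∀ w → (if p w then Qx G x w else 0ℤ) ≡ sum (λ z → inside w z + across w z)
    split w with p w
    ... | false = sym (sum-replicate-zero n)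
    ... | true  = trans (Qx≡∑flow x w) (sum-cong-≗ (by-side w))

  ∑Qx≡0 : ∀ x → sum (Qx G x) ≡ 0ℤ
  ∑Qx≡0 x = trans (sumWhere-Qx (λ _ → true) x)
    (trans (sum-cong-≗ {n} (λ _ → sum-replicate-zero n)) (sum-replicate-zero n))

  cutSize≡outflow : ∀ U → + cutSize G U ≡ outflow (lookup U) (𝟏 U)
  cutSize≡outflow U =
    trans (sumℕ≡sum {n} _) (sum-cong-≗ λ w → trans (sumℕ≡sum {n} _) (sum-cong-≗ (edge w)))
    where
    edge : ∀ w z → + (if lookup U w ∧ not (lookup U z) then adj G w z else 0)
                 ≡ (if lookup U w ∧ not (lookup U z) then flow (𝟏 U) w z else 0ℤ)
    edge w z with lookup U w | lookup U z
    ... | true  | false = sym (ℤₚ.*-identityʳ _)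
    ... | true  | true  = refl
    ... | false | _     = refl

  flow≤outflow : ∀ p x {a b} → (∀ w z → p w ≡ true → p z ≡ false → 0ℤ ≤ flow x w z) →
                 p a ≡ true → p b ≡ false → flow x a b ≤ outflow p x
  flow≤outflow p x {a} {b} leaving≥0 pa pb =
    ℤₚ.≤-trans (subst (_≤ sum (across a)) at-ab (≤-sum (across≥0 a) b))
               (≤-sum (λ w → sum-nonneg (across≥0 w)) a)
    where
    across : Fin n → Fin n → ℤ
    across w z = if p w ∧ not (p z) then flow x w z else 0ℤ
    across≥0 : ∀ w z → 0ℤ ≤ across w z
    across≥0 w z with p w in pw | p z in pz
    ... | true  | false = leaving≥0 w z pw pz
    ... | true  | true  = ℤₚ.≤-refl
    ... | false | _     = ℤₚ.≤-refl
    at-ab : across a b ≡ flow x a b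
    at-ab rewrite pa | pb = refl

  ─Q-+ : ∀ D x y w → ((D ─Q G · x) ─Q G · y) w ≡ (D ─Q G · (λ i → x i + y i)) w
  ─Q-+ D x y w =
    trans (assoc (D w) (Qx G x w) (Qx G y w)) (cong (_-_ (D w)) (sym (Qx-+ x y w)))
    where
    assoc : ∀ d a b → (d - a) - b ≡ d - (a + b)
    assoc = solve-∀

  deg-invariant : ∀ {D D'} → LinEquiv G D' D → deg D' ≡ deg D
  deg-invariant {D} {D'} (x , D'-D≡Qx) = begin
    deg D'                      ≡⟨ sumℤ≡sum D' ⟩
    sum D'                      ≡⟨ sum-cong-≗ (λ w → shift (D' w) (D w) _ (D'-D≡Qx w)) ⟩
    sum (λ w → D w + Qx G x w)  ≡⟨ ∑-distrib-+ D (Qx G x) ⟩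
    sum D + sum (Qx G x)        ≡⟨ cong (_+_ (sum D)) (∑Qx≡0 x) ⟩
    sum D + 0ℤ                  ≡⟨ ℤₚ.+-identityʳ _ ⟩
    sum D                       ≡⟨ sumℤ≡sum D ⟨
    deg D                       ∎
    where
    open ≡-Reasoning
    shift : ∀ a b c → a - b ≡ c → a ≡ b + c
    shift a b c refl = lemma a b
      where
      lemma : ∀ a b → a ≡ b + (a - b)
      lemma = solve-∀

  cut≤deg : ∀ {D} U → Effective D → Effective (D ─Q G · 𝟏 U) → + cutSize G U ≤ deg D
  cut≤deg {D} U D≥0 fired≥0 = begin
    + cutSize G U                     ≡⟨ cutSize≡outflow U ⟩
    outflow (lookup U) (𝟏 U)          ≡⟨ sumWhere-Qx (lookup U) (𝟏 U) ⟨
    sumWhere (lookup U) (Qx G (𝟏 U))  ≤⟨ sumWhere≤sum (lookup U) D≥0 (ℤₚ.0≤i-j⇒j≤i ∘ fired≥0) ⟩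
    sum D                             ≡⟨ sumℤ≡sum D ⟨
    deg D                             ∎
    where open ℤₚ.≤-Reasoning

len : ∀ {n} {G : Graph n} {a b} → Reach G a b → ℕ
len here       = 0
len (step _ r) = suc (len r)

reach-bound : ∀ {n} {G : Graph n} (φ : Fin n → ℤ) (d : ℕ) →
              (∀ {w z} → 0 ℕ.< adj G w z → φ w - φ z ≤ + d) →
              ∀ {a b} (r : Reach G a b) → φ a - φ b ≤ + (len r ℕ.* d)
reach-bound φ d edge {a} here = ℤₚ.≤-reflexive (ℤₚ.+-inverseʳ (φ a))
reach-bound φ d edge {a} {b} (step {w = w} e r) = subst (_≤ _) (telescope (φ a) (φ w) (φ b))
  (ℤₚ.+-mono-≤ (edge e) (reach-bound φ d edge r))
  where
  telescope : ∀ a w b → (a - w) + (w - b) ≡ a - b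
  telescope = solve-∀

-- Legal scripts and separations

𝟏-∈ : ∀ {n} {U : Subset n} {u} → u ∈ U → 𝟏 U u ≡ 1ℤ
𝟏-∈ u∈U rewrite []=⇒lookup u∈U = refl

𝟏-∉ : ∀ {n} {U : Subset n} {v} → v ∉ U → 𝟏 U v ≡ 0ℤ
𝟏-∉ {U = U} {v} v∉U with lookup U v in eq
... | true  = contradiction (lookup⇒[]= v U eq) v∉U
... | false = refl

𝟏-+-∁ : ∀ {n} (U : Subset n) i → 𝟏 U i + 𝟏 (∁ U) i ≡ 1ℤ
𝟏-+-∁ U i rewrite lookup-map i not U with lookup U i
... | true  = refl
... | false = refl

Legal : ∀ {n} → Graph n → Divisor n → (Fin n → ℤ) → Set
Legal G D x = Effective (D ─Q G · x)

-- In terms of SetFirable below: x fires D to D', and x + 𝟏 U fires D to D' − Q 𝟏 U.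
Separates : ∀ {n} → Graph n → Divisor n → Fin n → Fin n → Set
Separates {n} G D u v = Σ (Fin n → ℤ) λ x → Σ (Subset n) λ U →
  u ∈ U × v ∉ U × Legal G D x × Legal G D (λ i → x i + 𝟏 U i)

SetFirable : ∀ {n} → Graph n → Divisor n → Fin n → Fin n → Set
SetFirable {n} G D u v = Σ (Divisor n) λ D' → Effective D' × LinEquiv G D' D ×
  Σ (Subset n) λ U → u ∈ U × v ∉ U × Effective (D' ─Q G · 𝟏 U)

module Scripts {n : ℕ} (G : Graph n) (D : Divisor n) where
  open Laplacian G

  legal⇒Qx≤ : ∀ {x} → Legal G D x → ∀ w → Qx G x w ≤ D w
  legal⇒Qx≤ legal w = ℤₚ.0≤i-j⇒j≤i (legal w)

  Qx≤⇒legal : ∀ {x} → (∀ w → Qx G x w ≤ D w) → Legal G D x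
  Qx≤⇒legal Qx≤D w = ℤₚ.i≤j⇒0≤j-i (Qx≤D w)

  legal-cong : ∀ {x y} → (∀ i → x i ≡ y i) → Legal G D x → Legal G D y
  legal-cong x≗y legal w = subst (λ q → 0ℤ ≤ D w - q) (Qx-cong x≗y w) (legal w)

  legal-const : Effective D → ∀ c → Legal G D (λ _ → c)
  legal-const D≥0 c = Qx≤⇒legal λ w → subst (_≤ _) (sym (Qx-const c w)) (D≥0 w)

  legal-+const : ∀ {x} c → Legal G D x → Legal G D (λ i → x i + c)
  legal-+const {x} c legal w = subst (λ q → 0ℤ ≤ D w - q) (sym (Qx-+const x c w)) (legal w)

  legal-⊔ : ∀ {x y} → Legal G D x → Legal G D y → Legal G D (λ i → x i ⊔ y i)
  legal-⊔ {x} {y} legal-x legal-y = Qx≤⇒legal λ w → bound w (ℤₚ.⊔-sel (x w) (y w))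
    where
    bound : ∀ w → x w ⊔ y w ≡ x w ⊎ x w ⊔ y w ≡ y w → Qx G (λ i → x i ⊔ y i) w ≤ D w
    bound w (inj₁ eq) = ℤₚ.≤-trans (Qx-antitone {x} w (sym eq) (λ z → ℤₚ.i≤i⊔j (x z) (y z)))
                                   (legal⇒Qx≤ legal-x w)
    bound w (inj₂ eq) = ℤₚ.≤-trans (Qx-antitone {y} w (sym eq) (λ z → ℤₚ.i≤j⊔i (x z) (y z)))
                                   (legal⇒Qx≤ legal-y w)

  legal-edge : Effective D → ∀ {x} → Legal G D x → ∀ {a b} → 0 ℕ.< adj G a b →
               x a - x b ≤ deg D
  legal-edge D≥0 {x} legal {a} {b} ab with x a ℤ.≤? x b
  ... | yes xa≤xb = ℤₚ.≤-trans (ℤₚ.i≤j⇒i-j≤0 xa≤xb) (deg-nonneg D≥0)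
  ... | no  xa≰xb = begin
    x a - x b                ≤⟨ difference≤flow x ab (ℤₚ.<⇒≤ xb<xa) ⟩
    flow x a b               ≤⟨ flow≤outflow above x leaving≥0 a-above b-below ⟩
    outflow above x          ≡⟨ sumWhere-Qx above x ⟨
    sumWhere above (Qx G x)  ≤⟨ sumWhere≤sum above D≥0 (legal⇒Qx≤ legal) ⟩
    sum D                    ≡⟨ sumℤ≡sum D ⟨
    deg D                    ∎
    where
    open ℤₚ.≤-Reasoning
    xb<xa : x b < x a
    xb<xa = ℤₚ.≰⇒> xa≰xb
    above : Fin n → Bool
    above i = does (x a ℤ.≤? x i)
    a-above : above a ≡ true
    a-above = dec-true (x a ℤ.≤? x a) ℤₚ.≤-refl
    b-below : above b ≡ false
    b-below = dec-false (x a ℤ.≤? x b) (ℤₚ.<⇒≱ xb<xa)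
    leaving≥0 : ∀ w z → above w ≡ true → above z ≡ false → 0ℤ ≤ flow x w z
    leaving≥0 w z aw az with x a ℤ.≤? x w | x a ℤ.≤? x z
    leaving≥0 w z aw az | yes xa≤xw | no xa≰xz =
      flow-nonneg x (ℤₚ.<⇒≤ (ℤₚ.<-≤-trans (ℤₚ.≰⇒> xa≰xz) xa≤xw))
    leaving≥0 w z aw () | yes _     | yes _
    leaving≥0 w z () az | no _      | _

  separates⇒¬equiv : ∀ {u v} → Separates G D u v → ¬ EquivD G D u v
  separates⇒¬equiv {u} {v} (x , U , u∈U , v∉U , legal , legal-raised) equiv =
    contradiction (∙-cancelˡ (x u) 1ℤ 0ℤ (begin
      x u + 1ℤ     ≡⟨ cong (_+_ (x u)) (𝟏-∈ u∈U) ⟨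
      x u + 𝟏 U u  ≡⟨ equiv _ legal-raised ⟩
      x v + 𝟏 U v  ≡⟨ cong₂ _+_ (sym (equiv x legal)) (𝟏-∉ v∉U) ⟩
      x u + 0ℤ     ∎)) λ ()
    where open ≡-Reasoning

  separates-swap : ∀ {u v} → Separates G D v u → Separates G D u v
  separates-swap (x , W , v∈W , u∉W , legal , legal-raised) =
    (λ i → x i + 𝟏 W i) , ∁ W , x∉p⇒x∈∁p u∉W , x∈p⇒x∉∁p v∈W , legal-raised ,
    legal-cong complete (legal-+const 1ℤ legal)
    where
    complete : ∀ i → x i + 1ℤ ≡ (x i + 𝟏 W i) + 𝟏 (∁ W) i
    complete i = trans (cong (_+_ (x i)) (sym (𝟏-+-∁ W i))) (sym (ℤₚ.+-assoc (x i) _ _))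

  legal-<⇒separates : Effective D → ∀ {x u v} → Legal G D x → x u < x v →
                      Separates G D u v
  legal-<⇒separates D≥0 {x} {u} {v} legal xu<xv =
    (λ i → x i ⊔ x u) , U , u∈U , v∉U ,
    legal-⊔ legal (legal-const D≥0 (x u)) ,
    legal-cong raise (legal-⊔ legal (legal-const D≥0 (1ℤ + x u)))
    where
    below : Fin n → Bool
    below i = does (x i ℤ.≤? x u)
    U : Subset n
    U = tabulate below
    u∈U : u ∈ U
    u∈U = lookup⇒[]= u U (trans (lookup∘tabulate below u) (dec-true (x u ℤ.≤? x u) ℤₚ.≤-refl))
    v∉U : v ∉ U
    v∉U v∈U = contradiction (trans (sym ([]=⇒lookup v∈U)) (trans (lookup∘tabulate below v)
                (dec-false (x v ℤ.≤? x u) (ℤₚ.<⇒≱ xu<xv)))) λ ()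
    raise : ∀ i → x i ⊔ (1ℤ + x u) ≡ (x i ⊔ x u) + 𝟏 U i
    raise i rewrite lookup∘tabulate below i with x i ℤ.≤? x u
    ... | yes xi≤xu = trans (ℤₚ.i≤j⇒i⊔j≡j (ℤₚ.≤-trans xi≤xu (ℤₚ.i≤j+i (x u) 1ℤ)))
      (trans (ℤₚ.+-comm 1ℤ (x u)) (cong (_+ 1ℤ) (sym (ℤₚ.i≤j⇒i⊔j≡j xi≤xu))))
    ... | no  xi≰xu = trans (ℤₚ.i≥j⇒i⊔j≡i (ℤₚ.i<j⇒suc[i]≤j (ℤₚ.≰⇒> xi≰xu)))
      (sym (trans (ℤₚ.+-identityʳ _) (ℤₚ.i≥j⇒i⊔j≡i (ℤₚ.<⇒≤ (ℤₚ.≰⇒> xi≰xu)))))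

  legal-≢⇒separates : Effective D → ∀ {x u v} → Legal G D x → x u ≢ x v →
                      Separates G D u v
  legal-≢⇒separates D≥0 {x} {u} {v} legal xu≢xv with ℤₚ.<-cmp (x u) (x v)
  ... | tri< xu<xv _ _ = legal-<⇒separates D≥0 legal xu<xv
  ... | tri≈ _ xu≡xv _ = contradiction xu≡xv xu≢xv
  ... | tri> _ _ xv<xu = separates-swap (legal-<⇒separates D≥0 legal xv<xu)

  separates⇒setFirable : ∀ {u v} → Separates G D u v → SetFirable G D u v
  separates⇒setFirable (x , U , u∈U , v∉U , legal , legal-raised) =
    D ─Q G · x , legal , ((λ i → - x i) , fired) , U , u∈U , v∉U ,
    (λ w → subst (0ℤ ≤_) (sym (─Q-+ D x (𝟏 U) w)) (legal-raised w))
    where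
    fired : ∀ w → (D ─Q G · x) w - D w ≡ Qx G (λ i → - x i) w
    fired w = trans (cancel (D w) (Qx G x w)) (sym (Qx-neg x w))
      where
      cancel : ∀ d q → (d - q) - d ≡ - q
      cancel = solve-∀

  setFirable⇒separates : ∀ {u v} → SetFirable G D u v → Separates G D u v
  setFirable⇒separates (D' , D'≥0 , (x , D'-D≡Qx) , U , u∈U , v∉U , fired≥0) =
    (λ i → - x i) , U , u∈U , v∉U ,
    (λ w → subst (0ℤ ≤_) (sym (unfire w)) (D'≥0 w)) ,
    (λ w → subst (0ℤ ≤_) (trans (cong (_- Qx G (𝟏 U) w) (sym (unfire w))) (─Q-+ D _ (𝟏 U) w))
                 (fired≥0 w))
    where
    unfire : ∀ w → (D ─Q G · (λ i → - x i)) w ≡ D' w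
    unfire w = trans (cong (_-_ (D w)) (Qx-neg x w)) (restore (D w) (D' w) _ (D'-D≡Qx w))
      where
      restore : ∀ d d' q → d' - d ≡ q → d - - q ≡ d'
      restore d d' q refl = lemma d d'
        where
        lemma : ∀ d d' → d - - (d' - d) ≡ d'
        lemma = solve-∀

  separates⇒small-cut : ∀ {u v} → Separates G D u v →
                        Σ (Subset n) λ U → u ∈ U × v ∉ U × + cutSize G U ≤ deg D
  separates⇒small-cut sep with separates⇒setFirable sep
  ... | D' , D'≥0 , D'~D , U , u∈U , v∉U , fired≥0 =
    U , u∈U , v∉U , subst (_ ≤_) (deg-invariant D'~D) (cut≤deg U D'≥0 fired≥0)

-- Deciding u ≡_D v by a finite search

any-function? : ∀ {m n p} {P : Pred (Fin n → Fin m) p} →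
                (∀ {f g} → (∀ i → f i ≡ g i) → P f → P g) → Decidable P → Dec (∃ P)
any-function? resp P? = map′ (λ (k , Pk) → finToFun k , Pk)
  (λ (f , Pf) → funToFin f , resp (λ i → sym (finToFun-funToFin f i)) Pf)
  (any? (P? ∘ finToFun))

encode : ∀ m {i} → 0ℤ ≤ i → i ≤ + m → Σ (Fin (suc m)) λ k → + toℕ k ≡ i
encode m {+ k} _ (+≤+ k≤m) = fromℕ< (s≤s k≤m) , cong +_ (toℕ-fromℕ< (s≤s k≤m))

module BoundedSearch {n : ℕ} (G : Graph n) (conn : Connected G)
                     (D : Divisor n) (D≥0 : Effective D) (u v : Fin n) where
  open Scripts G D

  d : ℕ
  d = ℤ.∣ deg D ∣

  ℓ : Fin n → ℕ
  ℓ w = len (conn w v) ℕ.+ len (conn v w)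

  β : ℕ
  β = sumℕ ℓ ℕ.* d

  legal-edge-≤d : ∀ {x} → Legal G D x → ∀ {a b} → 0 ℕ.< adj G a b → x a - x b ≤ + d
  legal-edge-≤d legal ab =
    subst (_ ≤_) (sym (ℤₚ.0≤i⇒+∣i∣≡i (deg-nonneg D≥0))) (legal-edge D≥0 legal ab)

  legal-walk-≤β : ∀ {x} → Legal G D x → ∀ {a b} (r : Reach G a b) → len r ℕ.≤ sumℕ ℓ →
                  x a - x b ≤ + β
  legal-walk-≤β {x} legal r r≤ =
    ℤₚ.≤-trans (reach-bound x d (legal-edge-≤d legal) r) (+≤+ (ℕₚ.*-monoˡ-≤ d r≤))

  legal-near-v : ∀ {x} → Legal G D x → ∀ w → x w - x v ≤ + β × x v - x w ≤ + β
  legal-near-v legal w =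
    legal-walk-≤β legal (conn w v) (ℕₚ.≤-trans (ℕₚ.m≤m+n _ _) (≤-sumℕ ℓ w)) ,
    legal-walk-≤β legal (conn v w) (ℕₚ.≤-trans (ℕₚ.m≤n+m _ _) (≤-sumℕ ℓ w))

  Box : Set
  Box = Fin n → Fin (suc (β ℕ.+ β))

  toℤ : Box → Fin n → ℤ
  toℤ f i = + toℕ (f i)

  Candidate : Box → Set
  Candidate f = Legal G D (toℤ f) × toℤ f u ≢ toℤ f v

  candidate? : Decidable Candidate
  candidate? f = all? (λ w → 0ℤ ℤ.≤? (D ─Q G · toℤ f) w) ×-dec ¬? (toℤ f u ℤ.≟ toℤ f v)

  candidate-resp : ∀ {f g} → (∀ i → f i ≡ g i) → Candidate f → Candidate g
  candidate-resp f≗g (legal , fu≢fv) =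
    legal-cong (λ i → cong (+_ ∘ toℕ) (f≗g i)) legal ,
    λ eq → fu≢fv (trans (cong (+_ ∘ toℕ) (f≗g u)) (trans eq (cong (+_ ∘ toℕ) (sym (f≗g v)))))

  legal-≢⇒candidate : ∀ {x} → Legal G D x → x u ≢ x v → ∃ Candidate
  legal-≢⇒candidate {x} legal xu≢xv =
    f , legal-cong (λ i → sym (f≡y i)) (legal-+const c legal) , fu≢fv
    where
    c : ℤ
    c = + β - x v
    recentre : ∀ a b c → a + (c - b) ≡ c - (b - a)
    recentre = solve-∀
    recentre′ : ∀ a b c → a + (c - b) ≡ (a - b) + c
    recentre′ = solve-∀
    y≥0 : ∀ i → 0ℤ ≤ x i + c
    y≥0 i = subst (0ℤ ≤_) (sym (recentre (x i) (x v) (+ β)))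
      (ℤₚ.i≤j⇒0≤j-i (proj₂ (legal-near-v legal i)))
    y≤2β : ∀ i → x i + c ≤ + (β ℕ.+ β)
    y≤2β i = subst (_≤ + (β ℕ.+ β)) (sym (recentre′ (x i) (x v) (+ β)))
      (ℤₚ.+-monoˡ-≤ (+ β) (proj₁ (legal-near-v legal i)))
    f : Box
    f i = proj₁ (encode (β ℕ.+ β) (y≥0 i) (y≤2β i))
    f≡y : ∀ i → toℤ f i ≡ x i + c
    f≡y i = proj₂ (encode (β ℕ.+ β) (y≥0 i) (y≤2β i))
    fu≢fv : toℤ f u ≢ toℤ f v
    fu≢fv eq = xu≢xv (∙-cancelʳ c (x u) (x v) (trans (sym (f≡y u)) (trans eq (f≡y v))))

  equiv⊎separates : EquivD G D u v ⊎ Separates G D u v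
  equiv⊎separates with any-function? candidate-resp candidate?
  ... | yes (f , legal , fu≢fv) = inj₂ (legal-≢⇒separates D≥0 legal fu≢fv)
  ... | no ¬candidate           = inj₁ λ x legal →
    decidable-stable (x u ℤ.≟ x v) (¬candidate ∘ legal-≢⇒candidate legal)

lemma2 : ∀ {n} (G : Graph n) → Connected G → (D : Divisor n) → Effective D → (u v : Fin n) →
    ((¬ EquivD G D u v) ⇔
      (Σ (Divisor n) λ D' → Effective D' × LinEquiv G D' D ×
        Σ (Subset n) λ U → u ∈ U × v ∉ U × Effective (D' ─Q G · 𝟏 U)))
    × ((∀ (U : Subset n) → u ∈ U → v ∉ U → deg D < + cutSize G U) → EquivD G D u v)
lemma2 G conn D D≥0 u v =
  mk⇔ forward (separates⇒¬equiv ∘ setFirable⇒separates) , cut-criterion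
  where
  open Scripts G D
  open BoundedSearch G conn D D≥0 u v using (equiv⊎separates)
  forward : ¬ EquivD G D u v → SetFirable G D u v
  forward ¬equiv with equiv⊎separates
  ... | inj₁ equiv = contradiction equiv ¬equiv
  ... | inj₂ sep   = separates⇒setFirable sep
  cut-criterion : (∀ U → u ∈ U → v ∉ U → deg D < + cutSize G U) → EquivD G D u v
  cut-criterion large with equiv⊎separates
  ... | inj₁ equiv = equiv
  ... | inj₂ sep with separates⇒small-cut sep
  ...   | U , u∈U , v∉U , small = contradiction (large U u∈U v∉U) (ℤₚ.≤⇒≯ small)
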